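{- Define $a_0=1$ and $a_{n+1}=C_n-a_n$ for all $n\ge0$, where $C_n=\frac{1}{n+1}\binom{2n}{n}$ is the $n$th Catalan number. Then for all $n\geq 0$ and $\sigma\in\{213,312\}$, the number $d_n(\sigma)$ of desarrangements of length $n$ avoiding $\sigma$ equals $a_n$.
   Context: Permutations are in one-line notation; $\mathfrak{S}_0$ consists of the empty permutation, which is considered a desarrangement. An index $i\in[n-1]$ is a descent of $\pi\in\mathfrak{S}_n$ if $\pi_i>\pi_{i+1}$; $i\in[n]$ is an ascent if it is not a descent (so $n$ is always an ascent). A desarrangement is a permutation whose first ascent is even. $d_n(\Pi)$ is the number of desarrangements in $\mathfrak{S}_n$ avoiding every pattern in $\Pi$ ($\pi$ avoids $\sigma$ if no subsequence of $\pi$ has the same relative order as $\sigma$). -}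

module Defs where

open import Data.Nat using (ℕ; zero; suc; _+_; _<_; _≤_; _/_; _%_)
open import Data.Nat.Properties using (_≟_; _<?_)
open import Data.Nat.Combinatorics using (_C_)
open import Data.Integer using (ℤ; +_; _-_)
open import Data.List using (List; []; _∷_; map; concatMap; length; filter; upTo; _++_)
open import Data.List.Properties using (≡-dec)
open import Data.List.Relation.Unary.Any using (Any; any?)
open import Data.List.Relation.Unary.Unique.Propositional using (Unique)
open import Data.List.Relation.Unary.Unique.DecPropositional _≟_ using (unique?)
open import Data.Product using (_×_)
open import Relation.Nullary using (Dec; ¬_; ¬?; does)
open import Relation.Nullary.Decidable using (_×-dec_)
open import Relation.Binary.PropositionalEquality using (_≡_)
open import Data.Bool using (if_then_else_)

catalan : ℕ → ℕ
catalan n = ((n + n) C n) / suc n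

-- a_0 = 1, a_{n+1} = C_n - a_n  (in ℤ, so no truncation)
a : ℕ → ℤ
a zero = + 1
a (suc n) = + catalan n - a n

words : ℕ → ℕ → List (List ℕ)
words k zero = [] ∷ []
words k (suc n) = concatMap (λ x → map (x ∷_) (words k n)) (map suc (upTo k))

-- one-line notation: permutations of [n] = words of length n over [n]
-- with pairwise distinct entries (each appears exactly once)
IsPerm : List ℕ → Set
IsPerm = Unique

perms : ℕ → List (List ℕ)
perms n = filter unique? (words n n)

-- 1-based index of the first ascent (an index i with π_i < π_{i+1}, or i = n).
-- For the empty permutation we return 0 (even), matching the convention
-- that the empty permutation is a desarrangement.
firstAscent : List ℕ → ℕ
firstAscent [] = 0
firstAscent (x ∷ []) = 1
firstAscent (x ∷ y ∷ r) = if does (y <? x) then suc (firstAscent (y ∷ r)) else 1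

Desarrangement : List ℕ → Set
Desarrangement π = firstAscent π % 2 ≡ 0

desarrangement? : (π : List ℕ) → Dec (Desarrangement π)
desarrangement? π = (firstAscent π % 2) ≟ 0

subsequences : List ℕ → List (List ℕ)
subsequences [] = [] ∷ []
subsequences (x ∷ xs) = map (x ∷_) (subsequences xs) ++ subsequences xs

count< : ℕ → List ℕ → ℕ
count< x [] = 0
count< x (y ∷ ys) = if does (y <? x) then suc (count< x ys) else count< x ys

std : List ℕ → List ℕ
std τ = map (λ x → suc (count< x τ)) τ

Contains : List ℕ → List ℕ → Set
Contains σ π = Any (λ τ → std τ ≡ σ) (subsequences π)

Avoids : List ℕ → List ℕ → Set
Avoids σ π = ¬ Contains σ π

avoids? : (σ π : List ℕ) → Dec (Avoids σ π)
avoids? σ π = ¬? (any? (λ τ → ≡-dec _≟_ (std τ) σ) (subsequences π))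

d : ℕ → List ℕ → ℕ
d n σ = length (filter (λ π → desarrangement? π ×-dec avoids? σ π) (perms n))

-- Writing a permutation of [m+1] as its first entry k followed by its standardised tail τ, written k ◃ τ,
-- is a bijection onto the pairs (k, τ) with 1 ≤ k ≤ m+1 and τ a permutation of [m], and the whole
-- argument applies this decomposition to different sets of permutations.
--
-- Catalan numbers: k ◃ τ avoids 312 iff τ does and k ≤ τ₁ + 1. Hence the number G(m, k) of 312-avoiding
-- permutations of [m] with first entry ≥ k obeys the ballot recursion G(m+1, k+1) = G(m+1, k+2) + G(m, k),
-- so G(m, 0) = C(2m, m) − C(2m, m−1) = C_m. Reversal exchanges 213 and 312.
--
-- Desarrangements: k ◃ τ is a desarrangement iff τ₁ < k and τ is not one. Avoiding 312 then forces
-- k = τ₁ + 1, avoiding 213 forces k = m+2, so in both cases the σ-avoiding desarrangements of length m+2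
-- correspond to the σ-avoiding non-desarrangements of length m+1. Thus d_n + d_{n+1} = C_n, the recursion
-- that defines a_n.

module Submission where

open import Defs
open import Data.Bool using (true; false)
open import Data.Integer using (+_; _-_; _⊖_)
import Data.Integer.Properties as ℤ
open import Data.Nat using (ℕ; zero; suc; pred; _+_; _*_; _/_; _%_; _≤_; _<_; z≤n; s≤s; s≤s⁻¹; _<ᵇ_)
open import Data.Nat.Properties
open import Data.Nat.Combinatorics using (_C_; nCk+nC[k+1]≡[n+1]C[k+1]; nCk≡nC[n∸k]; nC1≡n)
open import Data.Nat.DivMod using (m*n/n≡m)
open import Data.Nat.Tactic.RingSolver using (solve-∀)
open import Data.List
  using (List; []; _∷_; _++_; length; filter; map; reverse; upTo; concatMap; cartesianProductWith)
open import Data.List.Properties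
  using (length-++; length-map; length-upTo; length-reverse; ∷-injective; filter-none; filter-≐;
         map-∘; map-cong; map-id; map-id-local; reverse-involutive)
open import Data.List.Relation.Unary.All using (All; []; _∷_)
import Data.List.Relation.Unary.All as All
import Data.List.Relation.Unary.All.Properties as AllP
open import Data.List.Relation.Unary.Any using (here; there)
open import Data.List.Relation.Unary.Unique.Propositional using (Unique; []; _∷_)
open import Data.List.Relation.Unary.Unique.DecPropositional _≟_ using (unique?)
import Data.List.Relation.Unary.Unique.Propositional.Properties as Unique
open import Data.List.Relation.Binary.Subset.Propositional using (_⊆_)
open import Data.List.Relation.Binary.Sublist.Propositional
  using ([]; _∷_; _∷ʳ_; to∈; from∈) renaming (_⊆_ to _⊑_)
import Data.List.Relation.Binary.Sublist.Propositional.Properties as Sublist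
open import Data.List.Relation.Binary.Permutation.Propositional using (↭⇒↭ₛ; ↭-sym)
open import Data.List.Relation.Binary.Permutation.Propositional.Properties using (↭-reverse; All-resp-↭)
import Data.List.Relation.Binary.Permutation.Setoid.Properties as PermutationSetoid
open import Data.List.Membership.Propositional using (_∈_; _∉_; find; lose)
open import Data.List.Membership.Propositional.Properties
  using (∈-∃++; ∈-++⁻; ∈-++⁺ˡ; ∈-++⁺ʳ; ∈-map⁺; ∈-map⁻; ∈-filter⁺; ∈-filter⁻; ∈-upTo⁺; ∈-upTo⁻;
         ∈-cartesianProductWith⁺; ∈-cartesianProductWith⁻)
open import Data.List.Membership.DecPropositional _≟_ using (_∈?_)
open import Data.Product using (_×_; _,_; proj₁; proj₂; ∃-syntax)
open import Data.Sum using (_⊎_; inj₁; inj₂; [_,_]′)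
open import Function using (id; _∘_; case_of_)
open import Function.Bundles using (_⇔_; mk⇔; Equivalence)
open import Level using (0ℓ)
open import Relation.Nullary using (¬_; yes; no; ¬?; contradiction)
open import Relation.Nullary.Decidable using (_×-dec_; dec-true; dec-false)
open import Relation.Nullary.Reflects using (ofʸ; ofⁿ)
open import Relation.Unary using (Pred; Decidable)
open import Relation.Binary.PropositionalEquality
  using (_≡_; _≢_; refl; sym; trans; cong; cong₂; subst; subst₂; setoid; module ≡-Reasoning)

open Equivalence using (to; from)

-- Counting through injections

count : {A : Set} {P : Pred A 0ℓ} → Decidable P → List A → ℕ
count P? xs = length (filter P? xs)

module _ {A : Set} where

  ⊆-++-∷⁻ : {x : A} {xs : List A} (ys zs : List A) → x ∉ xs → xs ⊆ ys ++ x ∷ zs → xs ⊆ ys ++ zs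
  ⊆-++-∷⁻ ys zs x∉xs xs⊆ z∈xs with ∈-++⁻ ys (xs⊆ z∈xs)
  ... | inj₁ z∈ys         = ∈-++⁺ˡ z∈ys
  ... | inj₂ (here refl)  = contradiction z∈xs x∉xs
  ... | inj₂ (there z∈zs) = ∈-++⁺ʳ ys z∈zs

  length-++-∷ : {x : A} (ys zs : List A) → length (ys ++ x ∷ zs) ≡ suc (length (ys ++ zs))
  length-++-∷ {x} ys zs = begin
    length (ys ++ x ∷ zs)          ≡⟨ length-++ ys ⟩
    length ys + suc (length zs)    ≡⟨ +-suc (length ys) (length zs) ⟩
    suc (length ys + length zs)    ≡⟨ cong suc (length-++ ys) ⟨
    suc (length (ys ++ zs))        ∎
    where open ≡-Reasoning

  Unique-⊆⇒length-≤ : {xs ys : List A} → Unique xs → xs ⊆ ys → length xs ≤ length ys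
  Unique-⊆⇒length-≤ {[]}     _            _     = z≤n
  Unique-⊆⇒length-≤ {x ∷ xs} u@(_ ∷ uxs) xs⊆ys
    with ys₁ , ys₂ , refl ← ∈-∃++ (xs⊆ys (here refl)) = begin
      suc (length xs)            ≤⟨ s≤s (Unique-⊆⇒length-≤ uxs xs⊆ys₁++ys₂) ⟩
      suc (length (ys₁ ++ ys₂))  ≡⟨ length-++-∷ ys₁ ys₂ ⟨
      length (ys₁ ++ x ∷ ys₂)    ∎
    where
    open ≤-Reasoning
    xs⊆ys₁++ys₂ : xs ⊆ ys₁ ++ ys₂
    xs⊆ys₁++ys₂ = ⊆-++-∷⁻ ys₁ ys₂ (Unique.Unique[x∷xs]⇒x∉xs u) (xs⊆ys ∘ there)

module _ {A B : Set} {P : Pred A 0ℓ} {Q : Pred B 0ℓ} where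

  Embeds : List A → List B → (A → B) → (B → A) → Set
  Embeds xs ys f g = ∀ {x} → x ∈ xs → P x → f x ∈ ys × Q (f x) × g (f x) ≡ x

  count-≤ : (P? : Decidable P) (Q? : Decidable Q) {xs : List A} {ys : List B} →
            Unique xs → (f : A → B) (g : B → A) → Embeds xs ys f g →
            count P? xs ≤ count Q? ys
  count-≤ P? Q? {xs} {ys} uxs f g emb = begin
    count P? xs                    ≡⟨ length-map f (filter P? xs) ⟨
    length (map f (filter P? xs))  ≤⟨ Unique-⊆⇒length-≤ unique image⊆ ⟩
    count Q? ys                    ∎
    where
    open ≤-Reasoning
    embed : ∀ {x} → x ∈ filter P? xs → f x ∈ ys × Q (f x) × g (f x) ≡ x
    embed x∈ = let x∈xs , px = ∈-filter⁻ P? x∈ in emb x∈xs px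
    unique : Unique (map f (filter P? xs))
    unique = Unique.map⁻ {f = g} (subst Unique (sym g∘f≡id) (Unique.filter⁺ P? uxs))
      where
      g∘f≡id : map g (map f (filter P? xs)) ≡ filter P? xs
      g∘f≡id = trans (sym (map-∘ (filter P? xs)))
                     (map-id-local (All.tabulate (λ x∈ → proj₂ (proj₂ (embed x∈)))))
    image⊆ : map f (filter P? xs) ⊆ filter Q? ys
    image⊆ y∈ with x , x∈ , refl ← ∈-map⁻ f y∈ =
      let fx∈ys , qfx , _ = embed x∈ in ∈-filter⁺ Q? fx∈ys qfx

count-≡ : {A B : Set} {P : Pred A 0ℓ} {Q : Pred B 0ℓ} (P? : Decidable P) (Q? : Decidable Q)
          {xs : List A} {ys : List B} → Unique xs → Unique ys → (f : A → B) (g : B → A) →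
          Embeds {P = P} {Q = Q} xs ys f g → Embeds {P = Q} {Q = P} ys xs g f →
          count P? xs ≡ count Q? ys
count-≡ P? Q? uxs uys f g f-emb g-emb =
  ≤-antisym (count-≤ P? Q? uxs f g f-emb) (count-≤ Q? P? uys g f g-emb)

module _ {A : Set} {P Q R : Pred A 0ℓ} (P? : Decidable P) (Q? : Decidable Q) (R? : Decidable R) where

  count-split : (∀ {x} → P x → Q x ⊎ R x) → (∀ {x} → Q x ⊎ R x → P x) → (∀ {x} → Q x → ¬ R x) →
                ∀ xs → count P? xs ≡ count Q? xs + count R? xs
  count-split split join disjoint [] = refl
  count-split split join disjoint (x ∷ xs) with P? x | Q? x | R? x
  ... | _      | yes qx | yes rx = contradiction rx (disjoint qx)
  ... | yes _  | yes _  | no _   = cong suc (count-split split join disjoint xs)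
  ... | yes _  | no _   | yes _  = trans (cong suc (count-split split join disjoint xs)) (sym (+-suc _ _))
  ... | yes px | no ¬qx | no ¬rx = contradiction (split px) [ ¬qx , ¬rx ]′
  ... | no ¬px | yes qx | no _   = contradiction (join (inj₁ qx)) ¬px
  ... | no ¬px | no _   | yes rx = contradiction (join (inj₂ rx)) ¬px
  ... | no _   | no _   | no _   = count-split split join disjoint xs

count-none : {A : Set} {P : Pred A 0ℓ} (P? : Decidable P) {xs : List A} →
             (∀ {x} → x ∈ xs → ¬ P x) → count P? xs ≡ 0
count-none P? none = cong length (filter-none P? (All.tabulate none))

-- Permutations of [n]

InRange : ℕ → ℕ → Set
InRange n x = 0 < x × x ≤ n

record IsPermOf (n : ℕ) (π : List ℕ) : Set where
  constructor isPermOf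
  field
    unique  : Unique π
    length≡ : length π ≡ n
    inRange : All (InRange n) π

∈-range⁺ : ∀ {n x} → InRange n x → x ∈ map suc (upTo n)
∈-range⁺ {x = suc x} (_ , x≤n) = ∈-map⁺ suc (∈-upTo⁺ x≤n)

∈-range⁻ : ∀ {n x} → x ∈ map suc (upTo n) → InRange n x
∈-range⁻ x∈ with i , i∈ , refl ← ∈-map⁻ suc x∈ = s≤s z≤n , ∈-upTo⁻ i∈

words-suc : ∀ k n → words k (suc n) ≡ cartesianProductWith _∷_ (map suc (upTo k)) (words k n)
words-suc k n = go (map suc (upTo k))
  where
  go : ∀ xs → concatMap (λ x → map (x ∷_) (words k n)) xs ≡ cartesianProductWith _∷_ xs (words k n)
  go []       = refl
  go (x ∷ xs) = cong (map (x ∷_) (words k n) ++_) (go xs)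

Unique-words : ∀ k n → Unique (words k n)
Unique-words k zero    = [] ∷ []
Unique-words k (suc n) rewrite words-suc k n =
  Unique.cartesianProductWith⁺ _∷_ ∷-injective
    (Unique.map⁺ suc-injective (Unique.upTo⁺ k)) (Unique-words k n)

∈-words⁺ : ∀ k n {π} → length π ≡ n → All (InRange k) π → π ∈ words k n
∈-words⁺ k zero    {[]}    _   []          = here refl
∈-words⁺ k (suc n) {x ∷ π} len (x∈ ∷ π∈) rewrite words-suc k n =
  ∈-cartesianProductWith⁺ _∷_ (∈-range⁺ x∈) (∈-words⁺ k n (suc-injective len) π∈)

∈-words⁻ : ∀ k n {π} → π ∈ words k n → length π ≡ n × All (InRange k) π
∈-words⁻ k zero    (here refl) = refl , []
∈-words⁻ k (suc n) π∈ rewrite words-suc k n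
  with x , ρ , x∈ , ρ∈ , refl ← ∈-cartesianProductWith⁻ _∷_ (map suc (upTo k)) (words k n) π∈ =
  let len , inRange = ∈-words⁻ k n ρ∈ in cong suc len , ∈-range⁻ x∈ ∷ inRange

Unique-perms : ∀ n → Unique (perms n)
Unique-perms n = Unique.filter⁺ unique? (Unique-words n n)

∈-perms⁺ : ∀ {n π} → IsPermOf n π → π ∈ perms n
∈-perms⁺ {n} (isPermOf u len inRange) = ∈-filter⁺ unique? (∈-words⁺ n n len inRange) u

∈-perms⁻ : ∀ {n π} → π ∈ perms n → IsPermOf n π
∈-perms⁻ {n} π∈ with π∈words , u ← ∈-filter⁻ unique? π∈ =
  let len , inRange = ∈-words⁻ n n π∈words in isPermOf u len inRange

IsPermOf⇒∈ : ∀ {n π v} → IsPermOf n π → InRange n v → v ∈ π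
IsPermOf⇒∈ {n} {π} {v} (isPermOf u len inRange) v∈range with v ∈? π
... | yes v∈π = v∈π
... | no v∉π with ys , zs , range≡ ← ∈-∃++ (∈-range⁺ v∈range) =
  contradiction (begin-strict
    length π                   ≤⟨ Unique-⊆⇒length-≤ u (⊆-++-∷⁻ ys zs v∉π π⊆range) ⟩
    length (ys ++ zs)          <⟨ ≤-reflexive (sym (length-++-∷ ys zs)) ⟩
    length (ys ++ v ∷ zs)      ≡⟨ cong length range≡ ⟨
    length (map suc (upTo n))  ≡⟨ trans (length-map suc (upTo n)) (length-upTo n) ⟩
    n                          ≡⟨ len ⟨
    length π                   ∎) (<-irrefl refl)
  where
  open ≤-Reasoning
  π⊆range : π ⊆ ys ++ v ∷ zs
  π⊆range z∈π = subst (_ ∈_) range≡ (∈-range⁺ (All.lookup inRange z∈π))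

-- Occurrences of patterns of length three

⊑⇒∈-subsequences : ∀ {τ π} → τ ⊑ π → τ ∈ subsequences π
⊑⇒∈-subsequences {π = []}    []       = here refl
⊑⇒∈-subsequences {π = x ∷ π} (_ ∷ʳ s) = ∈-++⁺ʳ (map (x ∷_) (subsequences π)) (⊑⇒∈-subsequences s)
⊑⇒∈-subsequences (refl ∷ s)           = ∈-++⁺ˡ (∈-map⁺ (_ ∷_) (⊑⇒∈-subsequences s))

∈-subsequences⇒⊑ : ∀ π {τ} → τ ∈ subsequences π → τ ⊑ π
∈-subsequences⇒⊑ []      (here refl) = []
∈-subsequences⇒⊑ (x ∷ π) τ∈ with ∈-++⁻ (map (x ∷_) (subsequences π)) τ∈
... | inj₁ τ∈xs with ρ , ρ∈ , refl ← ∈-map⁻ (x ∷_) τ∈xs = refl ∷ ∈-subsequences⇒⊑ π ρ∈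
... | inj₂ τ∈  = x ∷ʳ ∈-subsequences⇒⊑ π τ∈

⊑-map⁻ : ∀ {A B : Set} (f : A → B) ys {xs} → xs ⊑ map f ys → ∃[ zs ] (zs ⊑ ys × map f zs ≡ xs)
⊑-map⁻ f []       []         = [] , [] , refl
⊑-map⁻ f (y ∷ ys) (_ ∷ʳ s)   with zs , s′ , refl ← ⊑-map⁻ f ys s = zs , y ∷ʳ s′ , refl
⊑-map⁻ f (y ∷ ys) (refl ∷ s) with zs , s′ , refl ← ⊑-map⁻ f ys s = y ∷ zs , refl ∷ s′ , refl

count<-mono-≤ : ∀ τ {x y} → x ≤ y → count< x τ ≤ count< y τ
count<-mono-≤ []      x≤y = z≤n
count<-mono-≤ (w ∷ τ) {x} {y} x≤y with w <ᵇ x | <ᵇ-reflects-< w x | w <ᵇ y | <ᵇ-reflects-< w y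
... | true  | _        | true  | _         = s≤s (count<-mono-≤ τ x≤y)
... | true  | ofʸ w<x  | false | ofⁿ w≮y   = contradiction (<-≤-trans w<x x≤y) w≮y
... | false | _        | true  | _         = m≤n⇒m≤1+n (count<-mono-≤ τ x≤y)
... | false | _        | false | _         = count<-mono-≤ τ x≤y

count<-cancel-< : ∀ τ {x y} → count< x τ < count< y τ → x < y
count<-cancel-< τ c = ≰⇒> (λ y≤x → <⇒≱ c (count<-mono-≤ τ y≤x))

R312 R213 : ℕ → ℕ → ℕ → Set
R312 x y z = y < z × z < x
R213 x y z = y < x × x < z

std≡312⇔R312 : ∀ {x y z} → std (x ∷ y ∷ z ∷ []) ≡ 3 ∷ 1 ∷ 2 ∷ [] ⇔ R312 x y z
std≡312⇔R312 {x} {y} {z} = mk⇔ std⇒ ⇒std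
  where
  τ : List ℕ
  τ = x ∷ y ∷ z ∷ []
  std⇒ : std τ ≡ 3 ∷ 1 ∷ 2 ∷ [] → R312 x y z
  std⇒ e with ex , e′ ← ∷-injective e with ey , e″ ← ∷-injective e′ with ez , _ ← ∷-injective e″ =
    count<-cancel-< τ (subst₂ _<_ (sym (suc-injective ey)) (sym (suc-injective ez)) (n<1+n 0)) ,
    count<-cancel-< τ (subst₂ _<_ (sym (suc-injective ez)) (sym (suc-injective ex)) (n<1+n 1))
  ⇒std : R312 x y z → std τ ≡ 3 ∷ 1 ∷ 2 ∷ []
  ⇒std (y<z , z<x)
    rewrite dec-false (x <? x) (<-irrefl refl) | dec-true (y <? x) (<-trans y<z z<x) | dec-true (z <? x) z<x
          | dec-false (x <? y) (<-asym (<-trans y<z z<x)) | dec-false (y <? y) (<-irrefl refl)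
          | dec-false (z <? y) (<-asym y<z)
          | dec-false (x <? z) (<-asym z<x) | dec-true (y <? z) y<z | dec-false (z <? z) (<-irrefl refl)
    = refl

std≡213⇔R213 : ∀ {x y z} → std (x ∷ y ∷ z ∷ []) ≡ 2 ∷ 1 ∷ 3 ∷ [] ⇔ R213 x y z
std≡213⇔R213 {x} {y} {z} = mk⇔ std⇒ ⇒std
  where
  τ : List ℕ
  τ = x ∷ y ∷ z ∷ []
  std⇒ : std τ ≡ 2 ∷ 1 ∷ 3 ∷ [] → R213 x y z
  std⇒ e with ex , e′ ← ∷-injective e with ey , e″ ← ∷-injective e′ with ez , _ ← ∷-injective e″ =
    count<-cancel-< τ (subst₂ _<_ (sym (suc-injective ey)) (sym (suc-injective ex)) (n<1+n 0)) ,
    count<-cancel-< τ (subst₂ _<_ (sym (suc-injective ex)) (sym (suc-injective ez)) (n<1+n 1))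
  ⇒std : R213 x y z → std τ ≡ 2 ∷ 1 ∷ 3 ∷ []
  ⇒std (y<x , x<z)
    rewrite dec-false (x <? x) (<-irrefl refl) | dec-true (y <? x) y<x | dec-false (z <? x) (<-asym x<z)
          | dec-false (x <? y) (<-asym y<x) | dec-false (y <? y) (<-irrefl refl)
          | dec-false (z <? y) (<-asym (<-trans y<x x<z))
          | dec-true (x <? z) x<z | dec-true (y <? z) (<-trans y<x x<z) | dec-false (z <? z) (<-irrefl refl)
    = refl

record Occurrence (R : ℕ → ℕ → ℕ → Set) (π : List ℕ) : Set where
  constructor occurrence
  field
    x y z   : ℕ
    sublist : x ∷ y ∷ z ∷ [] ⊑ π
    related : R x y z

module _ {a b c : ℕ} {R : ℕ → ℕ → ℕ → Set}
         (std≡⇔R : ∀ {x y z} → std (x ∷ y ∷ z ∷ []) ≡ a ∷ b ∷ c ∷ [] ⇔ R x y z) where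

  Avoids⇔¬Occurrence : ∀ {π} → Avoids (a ∷ b ∷ c ∷ []) π ⇔ (¬ Occurrence R π)
  Avoids⇔¬Occurrence {π} = mk⇔ (λ avoids occ → avoids (contains occ)) (λ ¬occ c → ¬occ (occurs c))
    where
    contains : Occurrence R π → Contains (a ∷ b ∷ c ∷ []) π
    contains (occurrence x y z s r) = lose (⊑⇒∈-subsequences s) (from std≡⇔R r)
    triple : ∀ τ → τ ∈ subsequences π → std τ ≡ a ∷ b ∷ c ∷ [] → Occurrence R π
    triple (x ∷ y ∷ z ∷ []) τ∈ e = occurrence x y z (∈-subsequences⇒⊑ π τ∈) (to std≡⇔R e)
    occurs : Contains (a ∷ b ∷ c ∷ []) π → Occurrence R π
    occurs c with τ , τ∈ , e ← find c = triple τ τ∈ e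

module _ {R : ℕ → ℕ → ℕ → Set} (f : ℕ → ℕ) where

  Occurrence-map⁺ : (∀ {x y z} → R x y z → R (f x) (f y) (f z)) →
                    ∀ {π} → Occurrence R π → Occurrence R (map f π)
  Occurrence-map⁺ f-pres (occurrence x y z s r) = occurrence (f x) (f y) (f z) (Sublist.map⁺ f s) (f-pres r)

  Occurrence-map⁻ : (∀ {x y z} → R (f x) (f y) (f z) → R x y z) →
                    ∀ π → Occurrence R (map f π) → Occurrence R π
  Occurrence-map⁻ f-refl π (occurrence _ _ _ s r) with x ∷ y ∷ z ∷ [] , s′ , refl ← ⊑-map⁻ f π s =
    occurrence x y z s′ (f-refl r)

-- Punching a value into a permutation

punchIn : ℕ → ℕ → ℕ
punchIn k x with k ≤? x
... | yes _ = suc x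
... | no _  = x

punchOut : ℕ → ℕ → ℕ
punchOut k x with k <? x
... | yes _ = pred x
... | no _  = x

punchIn-< : ∀ {k x} → x < k → punchIn k x ≡ x
punchIn-< {k} {x} x<k with k ≤? x
... | yes k≤x = contradiction k≤x (<⇒≱ x<k)
... | no _    = refl

punchIn-<⁻ : ∀ {k x} → punchIn k x < k → x < k
punchIn-<⁻ {k} {x} p with k ≤? x
... | yes k≤x = contradiction (≤-trans k≤x (n≤1+n x)) (<⇒≱ p)
... | no _    = p

punchIn-mono-< : ∀ k {x y} → x < y → punchIn k x < punchIn k y
punchIn-mono-< k {x} {y} x<y with k ≤? x | k ≤? y
... | yes _   | yes _   = s≤s x<y
... | yes k≤x | no k≰y  = contradiction (≤-trans k≤x (<⇒≤ x<y)) k≰y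
... | no _    | yes _   = m<n⇒m<1+n x<y
... | no _    | no _    = x<y

punchIn-cancel-< : ∀ k {x y} → punchIn k x < punchIn k y → x < y
punchIn-cancel-< k {x} {y} p with k ≤? x | k ≤? y
... | yes _   | yes _   = s≤s⁻¹ p
... | yes _   | no _    = <-trans (n<1+n x) p
... | no k≰x  | yes k≤y = <-≤-trans (≰⇒> k≰x) k≤y
... | no _    | no _    = p

punchIn≢ : ∀ k x → punchIn k x ≢ k
punchIn≢ k x with k ≤? x
... | yes k≤x = λ e → <-irrefl (sym e) (s≤s k≤x)
... | no k≰x  = λ e → k≰x (≤-reflexive (sym e))

punchOut-punchIn : ∀ k x → punchOut k (punchIn k x) ≡ x
punchOut-punchIn k x with k ≤? x
... | yes k≤x with k <? suc x
...   | yes _    = refl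
...   | no k≮1+x = contradiction (s≤s k≤x) k≮1+x
punchOut-punchIn k x | no k≰x with k <? x
...   | yes k<x = contradiction (<⇒≤ k<x) k≰x
...   | no _    = refl

punchIn-punchOut : ∀ {k x} → x ≢ k → punchIn k (punchOut k x) ≡ x
punchIn-punchOut {k} {x} x≢k with k <? x
punchIn-punchOut {k} {suc x} x≢k | yes k<1+x with k ≤? x
... | yes _   = refl
... | no k≰x  = contradiction (s≤s⁻¹ k<1+x) k≰x
punchIn-punchOut {k} {x} x≢k | no k≮x with k ≤? x
... | yes k≤x = contradiction (≤∧≢⇒< k≤x (x≢k ∘ sym)) k≮x
... | no _    = refl

record OrderEmbedding (f : ℕ → ℕ) : Set where
  field
    mono   : ∀ {x y} → x < y → f x < f y
    cancel : ∀ {x y} → f x < f y → x < y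

module _ {f : ℕ → ℕ} (emb : OrderEmbedding f) where
  open OrderEmbedding emb

  firstAscent-map : ∀ τ → firstAscent (map f τ) ≡ firstAscent τ
  firstAscent-map []          = refl
  firstAscent-map (x ∷ [])    = refl
  firstAscent-map (x ∷ y ∷ r)
    with ih ← firstAscent-map (y ∷ r) | f y <ᵇ f x | <ᵇ-reflects-< (f y) (f x) | y <ᵇ x | <ᵇ-reflects-< y x
  ... | true  | _     | true  | _     = cong suc ih
  ... | true  | ofʸ p | false | ofⁿ q = contradiction (cancel p) q
  ... | false | ofⁿ p | true  | ofʸ q = contradiction (mono q) p
  ... | false | _     | false | _     = refl

  Desarrangement-map : ∀ τ → Desarrangement (map f τ) ⇔ Desarrangement τ
  Desarrangement-map τ = mk⇔ (subst (λ n → n % 2 ≡ 0) (firstAscent-map τ))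
                             (subst (λ n → n % 2 ≡ 0) (sym (firstAscent-map τ)))

  Occurrence312-map⁺ : ∀ {π} → Occurrence R312 π → Occurrence R312 (map f π)
  Occurrence312-map⁺ = Occurrence-map⁺ f λ (p , q) → mono p , mono q

  Occurrence312-map⁻ : ∀ π → Occurrence R312 (map f π) → Occurrence R312 π
  Occurrence312-map⁻ = Occurrence-map⁻ f λ (p , q) → cancel p , cancel q

  Occurrence213-map⁺ : ∀ {π} → Occurrence R213 π → Occurrence R213 (map f π)
  Occurrence213-map⁺ = Occurrence-map⁺ f λ (p , q) → mono p , mono q

  Occurrence213-map⁻ : ∀ π → Occurrence R213 (map f π) → Occurrence R213 π
  Occurrence213-map⁻ = Occurrence-map⁻ f λ (p , q) → cancel p , cancel q

punchIn-orderEmbedding : ∀ k → OrderEmbedding (punchIn k)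
punchIn-orderEmbedding k = record { mono = punchIn-mono-< k ; cancel = punchIn-cancel-< k }

punchIn-injective : ∀ k {x y} → punchIn k x ≡ punchIn k y → x ≡ y
punchIn-injective k {x} {y} e =
  trans (sym (punchOut-punchIn k x)) (trans (cong (punchOut k) e) (punchOut-punchIn k y))

-- Splitting off the first entry

-- Junk value hd [] = 0: the empty permutation counts as having first entry ≥ 0, so count312≥ 0 0 = 1.
hd : List ℕ → ℕ
hd []      = 0
hd (x ∷ _) = x

infixr 5 _◃_
_◃_ : ℕ → List ℕ → List ℕ
k ◃ τ = k ∷ map (punchIn k) τ

stdTail : List ℕ → List ℕ
stdTail []      = []
stdTail (k ∷ ρ) = map (punchOut k) ρ

stdTail-◃ : ∀ k τ → stdTail (k ◃ τ) ≡ τ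
stdTail-◃ k τ = trans (sym (map-∘ τ)) (trans (map-cong (punchOut-punchIn k) τ) (map-id τ))

map-punchIn-punchOut : ∀ {k ρ} → k ∉ ρ → map (punchIn k) (map (punchOut k) ρ) ≡ ρ
map-punchIn-punchOut {k} {ρ} k∉ρ = trans (sym (map-∘ ρ)) (map-id-local (All.tabulate punchIn-punchOut-∈))
  where
  punchIn-punchOut-∈ : ∀ {x} → x ∈ ρ → punchIn k (punchOut k x) ≡ x
  punchIn-punchOut-∈ x∈ρ = punchIn-punchOut (λ { refl → k∉ρ x∈ρ })

punchIn-InRange : ∀ {n k x} → InRange n x → InRange (suc n) (punchIn k x)
punchIn-InRange {n} {k} {x} (0<x , x≤n) with k ≤? x
... | yes _ = s≤s z≤n , s≤s x≤n
... | no _  = 0<x , m≤n⇒m≤1+n x≤n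

punchOut-InRange : ∀ {n k x} → InRange (suc n) k → x ≢ k → InRange (suc n) x → InRange n (punchOut k x)
punchOut-InRange {n} {k} {x} (0<k , k≤) x≢k (0<x , x≤) with k <? x
punchOut-InRange {x = suc x} (0<k , k≤) x≢k (0<x , x≤) | yes k<1+x =
  <-≤-trans 0<k (s≤s⁻¹ k<1+x) , s≤s⁻¹ x≤
... | no k≮x = 0<x , s≤s⁻¹ (<-≤-trans (≤∧≢⇒< (≮⇒≥ k≮x) x≢k) k≤)

hd-≤ : ∀ {m τ} → IsPermOf m τ → hd τ ≤ m
hd-≤ {τ = []}    _                           = z≤n
hd-≤ {τ = _ ∷ _} (isPermOf _ _ ((_ , x≤) ∷ _)) = x≤

◃-IsPermOf : ∀ {m k τ} → IsPermOf m τ → InRange (suc m) k → IsPermOf (suc m) (k ◃ τ)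
◃-IsPermOf {m} {k} {τ} (isPermOf u len inRange) k∈ = isPermOf
  (AllP.map⁺ (All.universal (λ x → punchIn≢ k x ∘ sym) τ) ∷ Unique.map⁺ (punchIn-injective k) u)
  (cong suc (trans (length-map (punchIn k) τ) len))
  (k∈ ∷ AllP.map⁺ (All.map punchIn-InRange inRange))

stdTail-IsPermOf : ∀ {m π} → IsPermOf (suc m) π → IsPermOf m (stdTail π)
stdTail-IsPermOf {m} {k ∷ ρ} (isPermOf u@(_ ∷ uρ) len (k∈ ∷ inRange)) = isPermOf
  (Unique.map⁻ (subst Unique (sym (map-punchIn-punchOut k∉ρ)) uρ))
  (trans (length-map (punchOut k) ρ) (suc-injective len))
  (AllP.map⁺ (All.tabulate λ x∈ρ → punchOut-InRange k∈ (λ { refl → k∉ρ x∈ρ }) (All.lookup inRange x∈ρ)))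
  where
  k∉ρ : k ∉ ρ
  k∉ρ = Unique.Unique[x∷xs]⇒x∉xs u

hd-◃-stdTail : ∀ {m π} → IsPermOf (suc m) π → hd π ◃ stdTail π ≡ π
hd-◃-stdTail {π = k ∷ ρ} (isPermOf u _ _) = cong (k ∷_) (map-punchIn-punchOut (Unique.Unique[x∷xs]⇒x∉xs u))

module _ {P Q : Pred (List ℕ) 0ℓ} (P? : Decidable P) (Q? : Decidable Q) {m : ℕ} (κ : List ℕ → ℕ) where

  count-◃ : (∀ {τ} → IsPermOf m τ → Q τ → InRange (suc m) (κ τ) × P (κ τ ◃ τ)) →
            (∀ {π} → IsPermOf (suc m) π → P π → Q (stdTail π) × κ (stdTail π) ≡ hd π) →
            count P? (perms (suc m)) ≡ count Q? (perms m)
  count-◃ insert-ok remove-ok =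
    count-≡ P? Q? (Unique-perms (suc m)) (Unique-perms m) stdTail (λ τ → κ τ ◃ τ) remove insert
    where
    remove : Embeds {P = P} {Q = Q} (perms (suc m)) (perms m) stdTail (λ τ → κ τ ◃ τ)
    remove {π} π∈ pπ with q , κ≡hd ← remove-ok (∈-perms⁻ {suc m} π∈) pπ =
      ∈-perms⁺ (stdTail-IsPermOf (∈-perms⁻ {suc m} π∈)) , q ,
      trans (cong (_◃ stdTail π) κ≡hd) (hd-◃-stdTail (∈-perms⁻ {suc m} π∈))
    insert : Embeds {P = Q} {Q = P} (perms m) (perms (suc m)) (λ τ → κ τ ◃ τ) stdTail
    insert {τ} τ∈ qτ with k∈ , p ← insert-ok (∈-perms⁻ {m} τ∈) qτ =
      ∈-perms⁺ (◃-IsPermOf (∈-perms⁻ {m} τ∈) k∈) , p , stdTail-◃ (κ τ) τ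

[1+n]%2≡0⇔n%2≢0 : ∀ n → suc n % 2 ≡ 0 ⇔ (n % 2 ≢ 0)
[1+n]%2≡0⇔n%2≢0 zero          = mk⇔ (λ ()) (λ 0≢0 → contradiction refl 0≢0)
[1+n]%2≡0⇔n%2≢0 (suc zero)    = mk⇔ (λ _ ()) (λ _ → refl)
[1+n]%2≡0⇔n%2≢0 (suc (suc n)) = [1+n]%2≡0⇔n%2≢0 n

Desarrangement-∷∷ : ∀ {x y r} → Desarrangement (x ∷ y ∷ r) ⇔ (y < x × ¬ Desarrangement (y ∷ r))
Desarrangement-∷∷ {x} {y} {r} with y <ᵇ x | <ᵇ-reflects-< y x
... | true  | ofʸ y<x = mk⇔ (λ d → y<x , to ([1+n]%2≡0⇔n%2≢0 (firstAscent (y ∷ r))) d)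
                            (λ (_ , ¬d) → from ([1+n]%2≡0⇔n%2≢0 (firstAscent (y ∷ r))) ¬d)
... | false | ofⁿ y≮x = mk⇔ (λ ()) (λ (y<x , _) → contradiction y<x y≮x)

Desarrangement-◃ : ∀ k τ → Desarrangement (k ◃ τ) ⇔ (hd τ < k × ¬ Desarrangement τ)
Desarrangement-◃ k []      = mk⇔ (λ ()) (λ (_ , ¬d) → contradiction refl ¬d)
Desarrangement-◃ k (h ∷ t) = mk⇔
  (λ d → let h′<k , ¬d′ = to ∷∷⇔ d in punchIn-<⁻ h′<k , ¬d′ ∘ from map⇔)
  (λ (h<k , ¬d) → from ∷∷⇔ (subst (_< k) (sym (punchIn-< h<k)) h<k , ¬d ∘ to map⇔))
  where
  ∷∷⇔ : Desarrangement (k ◃ h ∷ t) ⇔ (punchIn k h < k × ¬ Desarrangement (map (punchIn k) (h ∷ t)))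
  ∷∷⇔ = Desarrangement-∷∷ {r = map (punchIn k) t}
  map⇔ : Desarrangement (map (punchIn k) (h ∷ t)) ⇔ Desarrangement (h ∷ t)
  map⇔ = Desarrangement-map (punchIn-orderEmbedding k) (h ∷ t)

-- The 1 and 2 of a 312 through k lie below k, hence weakly below τ₁; as the 1 cannot be τ₁ itself,
-- τ₁ followed by them is a 312 in τ.
◃-avoids312 : ∀ {k τ} → Unique τ → ¬ Occurrence R312 τ → k ≤ suc (hd τ) → ¬ Occurrence R312 (k ◃ τ)
◃-avoids312 {k} {τ} _ ¬occ _ (occurrence _ y z (_ ∷ʳ s) r) =
  ¬occ (Occurrence312-map⁻ (punchIn-orderEmbedding k) τ (occurrence _ y z s r))
◃-avoids312 {k} {h ∷ t} u ¬occ k≤ (occurrence _ _ _ (refl ∷ s) (y<z , z<k))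
  with y′ ∷ z′ ∷ [] , s′ , refl ← ⊑-map⁻ (punchIn k) (h ∷ t) s = below-head s′
  where
  y′<z′ : y′ < z′
  y′<z′ = punchIn-cancel-< k y<z
  z′≤h : z′ ≤ h
  z′≤h = s≤s⁻¹ (<-≤-trans (punchIn-<⁻ z<k) k≤)
  below-head : ¬ (y′ ∷ z′ ∷ [] ⊑ h ∷ t)
  below-head (refl ∷ _)   = <⇒≱ y′<z′ z′≤h
  below-head (_ ∷ʳ y′z′⊑t) = ¬occ (occurrence h y′ z′ (refl ∷ y′z′⊑t) (y′<z′ , z′<h))
    where
    z′<h : z′ < h
    z′<h = ≤∧≢⇒< z′≤h λ { refl → Unique.Unique[x∷xs]⇒x∉xs u (to∈ (Sublist.∷ˡ⁻ y′z′⊑t)) }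

-- If k > τ₁ + 1 then k, τ₁, τ₁ + 1 is a 312 in k ◃ τ.
◃-avoids312⇒≤ : ∀ {m k τ} → IsPermOf m τ → k ≤ suc m → ¬ Occurrence R312 (k ◃ τ) → k ≤ suc (hd τ)
◃-avoids312⇒≤ {τ = []} (isPermOf _ refl _) k≤1+m _ = k≤1+m
◃-avoids312⇒≤ {m} {k} {h ∷ t} τperm k≤1+m ¬occ with k ≤? suc h
... | yes k≤1+h = k≤1+h
... | no k≰1+h  =
  contradiction (occurrence k _ _ (refl ∷ refl ∷ from∈ (∈-map⁺ (punchIn k) 1+h∈t)) 312-shape) ¬occ
  where
  1+h<k : suc h < k
  1+h<k = ≰⇒> k≰1+h
  1+h∈t : suc h ∈ t
  1+h∈t with IsPermOf⇒∈ τperm (s≤s z≤n , s≤s⁻¹ (<-≤-trans 1+h<k k≤1+m))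
  ... | here 1+h≡h = contradiction 1+h≡h 1+n≢n
  ... | there 1+h∈t = 1+h∈t
  312-shape : R312 k (punchIn k h) (punchIn k (suc h))
  312-shape = punchIn-mono-< k (n<1+n h) , subst (_< k) (sym (punchIn-< 1+h<k)) 1+h<k

stdTail-Desarrangement : ∀ {m π} → IsPermOf (suc m) π → Desarrangement π →
                         hd (stdTail π) < hd π × ¬ Desarrangement (stdTail π)
stdTail-Desarrangement {π = π} πperm d =
  to (Desarrangement-◃ (hd π) (stdTail π)) (subst Desarrangement (sym (hd-◃-stdTail πperm)) d)

◃-Occurrence : ∀ {R k τ} → Occurrence R (map (punchIn k) τ) → Occurrence R (k ◃ τ)
◃-Occurrence {k = k} (occurrence x y z s r) = occurrence x y z (k ∷ʳ s) r

stdTail-Occurrence : ∀ {R m π} → (∀ {k τ} → Occurrence R τ → Occurrence R (map (punchIn k) τ)) →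
                     IsPermOf (suc m) π → Occurrence R (stdTail π) → Occurrence R π
stdTail-Occurrence {R} map⁺ πperm occ = subst (Occurrence R) (hd-◃-stdTail πperm) (◃-Occurrence (map⁺ occ))

stdTail-avoids312 : ∀ {m π} → IsPermOf (suc m) π → ¬ Occurrence R312 π →
                    ¬ Occurrence R312 (stdTail π) × hd π ≤ suc (hd (stdTail π))
stdTail-avoids312 πperm ¬occ =
  ¬occ ∘ stdTail-Occurrence (Occurrence312-map⁺ (punchIn-orderEmbedding _)) πperm ,
  ◃-avoids312⇒≤ (stdTail-IsPermOf πperm) (hd-≤ πperm)
    (subst (¬_ ∘ Occurrence R312) (sym (hd-◃-stdTail πperm)) ¬occ)

-- Ballot numbers

-- n C⁻ k is n C (k - 1), read as 0 at k = 0 (where truncated subtraction would give n C 0 = 1).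
_C⁻_ : ℕ → ℕ → ℕ
n C⁻ zero    = 0
n C⁻ (suc k) = n C k

pascal : ∀ n k → suc n C suc k ≡ n C k + n C suc k
pascal n k = sym (nCk+nC[k+1]≡[n+1]C[k+1] n k)

pascal⁻ : ∀ n k → suc n C k ≡ n C⁻ k + n C k
pascal⁻ n zero    = refl
pascal⁻ n (suc k) = pascal n k

C-sym : ∀ a b → (a + b) C a ≡ (a + b) C b
C-sym a b = trans (nCk≡nC[n∸k] (m≤m+n a b)) (cong ((a + b) C_) (m+n∸m≡n a b))

absorption : ∀ n k → suc k * (suc n C suc k) ≡ suc n * (n C k)
absorption zero    zero    = refl
absorption zero    (suc k) = *-zeroʳ (suc (suc k))
absorption (suc n) zero    =
  trans (*-identityˡ _) (trans (nC1≡n (suc (suc n))) (sym (*-identityʳ (suc (suc n)))))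
absorption (suc n) (suc k) = begin
  suc (suc k) * (suc (suc n) C suc (suc k))    ≡⟨ cong (suc (suc k) *_) (pascal (suc n) (suc k)) ⟩
  suc (suc k) * (A + B)                        ≡⟨ expand k A B ⟩
  (A + suc k * A) + suc (suc k) * B            ≡⟨ cong₂ (λ x y → (A + x) + y) (absorption n k)
                                                                                (absorption n (suc k)) ⟩
  (A + suc n * (n C k)) + suc n * (n C suc k)  ≡⟨ collect A (suc n) (n C k) (n C suc k) ⟩
  A + suc n * (n C k + n C suc k)              ≡⟨ cong (λ x → A + suc n * x) (pascal n k) ⟨
  suc (suc n) * A                              ∎
  where
  open ≡-Reasoning
  A B : ℕ
  A = suc n C suc k
  B = suc n C suc (suc k)
  expand : ∀ k A B → suc (suc k) * (A + B) ≡ (A + suc k * A) + suc (suc k) * B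
  expand = solve-∀
  collect : ∀ A s a b → (A + s * a) + s * b ≡ A + s * (a + b)
  collect = solve-∀

central-absorption : ∀ n → suc n * ((n + n) C⁻ n) ≡ n * ((n + n) C n)
central-absorption zero    = refl
central-absorption (suc m) = begin
  suc (suc m) * (M C m)                 ≡⟨ cong (λ x → suc (suc m) * (x C m)) (+-suc m (suc m)) ⟨
  suc (suc m) * (L C m)                 ≡⟨ cong (suc (suc m) *_) (C-sym m (suc (suc m))) ⟩
  suc (suc m) * (L C suc (suc m))       ≡⟨ cong (λ x → suc (suc m) * (x C suc (suc m))) L≡1+M′ ⟩
  suc (suc m) * (suc M′ C suc (suc m))  ≡⟨ absorption M′ (suc m) ⟩
  suc M′ * (M′ C suc m)                 ≡⟨ cong (suc M′ *_) (C-sym (suc m) m) ⟩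
  suc M′ * (M′ C m)                     ≡⟨ absorption M′ m ⟨
  suc m * (suc M′ C suc m)              ≡⟨ cong (λ x → suc m * (x C suc m)) M≡1+M′ ⟨
  suc m * (M C suc m)                   ∎
  where
  open ≡-Reasoning
  M L M′ : ℕ
  M = suc m + suc m
  L = m + suc (suc m)
  M′ = suc m + m
  M≡1+M′ : M ≡ suc M′
  M≡1+M′ = +-suc (suc m) m
  L≡1+M′ : L ≡ suc M′
  L≡1+M′ = trans (+-suc m (suc m)) (cong suc (+-suc m m))

module Ballot (g : ℕ → ℕ → ℕ)
              (g-diagonal : ∀ m → g m m ≡ 1)
              (g-zero : ∀ m → g (suc m) 0 ≡ g (suc m) 1)
              (g-suc : ∀ m k → g (suc m) (suc k) ≡ g (suc m) (suc (suc k)) + g m k) where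

  -- g m k is the ballot number (2m-k choose m-k) - (2m-k choose m-k-1), written without subtraction.
  ballot : ∀ {m} j k → k + j ≡ m → g m k + (m + j) C⁻ j ≡ (m + j) C j
  ballot zero k refl rewrite +-identityʳ k = cong (_+ 0) (g-diagonal k)
  ballot (suc j) zero refl = begin
    g (suc j) 0 + suc N C j           ≡⟨ cong₂ _+_ (g-zero j) (pascal⁻ N j) ⟩
    g (suc j) 1 + (N C⁻ j + N C j)    ≡⟨ +-assoc (g (suc j) 1) (N C⁻ j) (N C j) ⟨
    (g (suc j) 1 + N C⁻ j) + N C j    ≡⟨ cong (_+ N C j) ih ⟩
    N C j + N C j                     ≡⟨ cong (_+_ (N C j)) (C-sym j (suc j)) ⟩
    N C j + N C suc j                 ≡⟨ pascal N j ⟨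
    suc N C suc j                     ∎
    where
    open ≡-Reasoning
    N : ℕ
    N = j + suc j
    ih : g (suc j) 1 + N C⁻ j ≡ N C j
    ih = subst (λ n → g (suc j) 1 + n C⁻ j ≡ n C j) (sym (+-suc j j)) (ballot j 1 refl)
  ballot {suc m} (suc j) (suc k) refl = begin
    g (suc m) (suc k) + suc N C j                         ≡⟨ cong₂ _+_ (g-suc m k) (pascal⁻ N j) ⟩
    (g (suc m) (suc (suc k)) + g m k) + (N C⁻ j + N C j)  ≡⟨ interchange (g (suc m) (suc (suc k))) _ _ (N C j) ⟩
    (g (suc m) (suc (suc k)) + N C⁻ j) + (g m k + N C j)  ≡⟨ cong₂ _+_ ih₁ (ballot (suc j) k refl) ⟩
    N C j + N C suc j                                     ≡⟨ pascal N j ⟨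
    suc N C suc j                                         ∎
    where
    open ≡-Reasoning
    N : ℕ
    N = m + suc j
    ih₁ : g (suc m) (suc (suc k)) + N C⁻ j ≡ N C j
    ih₁ = subst (λ n → g (suc m) (suc (suc k)) + n C⁻ j ≡ n C j) (sym (+-suc m j))
                (ballot j (suc (suc k)) (cong suc (sym (+-suc k j))))
    interchange : ∀ a b c d → (a + b) + (c + d) ≡ (a + c) + (b + d)
    interchange = solve-∀

  g≡catalan : ∀ n → g n 0 ≡ catalan n
  g≡catalan n = sym (trans (cong (_/ suc n) (sym g*[1+n]≡B)) (m*n/n≡m (g n 0) (suc n)))
    where
    B : ℕ
    B = (n + n) C n
    g*[1+n]≡B : g n 0 * suc n ≡ B
    g*[1+n]≡B = trans (*-comm (g n 0) (suc n)) (+-cancelʳ-≡ (n * B) (suc n * g n 0) B (begin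
      suc n * g n 0 + n * B                    ≡⟨ cong (_+_ (suc n * g n 0)) (central-absorption n) ⟨
      suc n * g n 0 + suc n * ((n + n) C⁻ n)   ≡⟨ *-distribˡ-+ (suc n) (g n 0) _ ⟨
      suc n * (g n 0 + (n + n) C⁻ n)           ≡⟨ cong (suc n *_) (ballot n 0 refl) ⟩
      suc n * B                                ∎))
      where open ≡-Reasoning

-- Catalan many 312- and 213-avoiders

p312 p213 : List ℕ
p312 = 3 ∷ 1 ∷ 2 ∷ []
p213 = 2 ∷ 1 ∷ 3 ∷ []

Avoids312⇔ : ∀ {π} → Avoids p312 π ⇔ (¬ Occurrence R312 π)
Avoids312⇔ = Avoids⇔¬Occurrence std≡312⇔R312

Avoids213⇔ : ∀ {π} → Avoids p213 π ⇔ (¬ Occurrence R213 π)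
Avoids213⇔ = Avoids⇔¬Occurrence std≡213⇔R213

avoids312-head≥? : ∀ k → Decidable (λ τ → Avoids p312 τ × k ≤ hd τ)
avoids312-head≥? k τ = avoids? p312 τ ×-dec (k ≤? hd τ)

avoids312-head≡? : ∀ k → Decidable (λ π → Avoids p312 π × hd π ≡ k)
avoids312-head≡? k π = avoids? p312 π ×-dec (hd π ≟ k)

count312≥ count312≡ : ℕ → ℕ → ℕ
count312≥ m k = count (avoids312-head≥? k) (perms m)
count312≡ m k = count (avoids312-head≡? k) (perms m)

count312≥-split : ∀ m k → count312≥ m k ≡ count312≥ m (suc k) + count312≡ m k
count312≥-split m k =
  count-split (avoids312-head≥? k) (avoids312-head≥? (suc k)) (avoids312-head≡? k)
    (λ {τ} → split {τ})
    (λ { (inj₁ (av , k<hd)) → av , <⇒≤ k<hd ; (inj₂ (av , refl)) → av , ≤-refl })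
    (λ (_ , k<hd) (_ , hd≡k) → <-irrefl (sym hd≡k) k<hd)
    (perms m)
  where
  split : ∀ {τ} → Avoids p312 τ × k ≤ hd τ → (Avoids p312 τ × k < hd τ) ⊎ (Avoids p312 τ × hd τ ≡ k)
  split {τ} (av , k≤hd) with k ≟ hd τ
  ... | yes k≡hd = inj₂ (av , sym k≡hd)
  ... | no k≢hd  = inj₁ (av , ≤∧≢⇒< k≤hd k≢hd)

count312≡-suc : ∀ m k → count312≡ (suc m) (suc k) ≡ count312≥ m k
count312≡-suc m k = count-◃ (avoids312-head≡? (suc k)) (avoids312-head≥? k) {m} (λ _ → suc k)
  (λ τperm (av , k≤hd) →
    (s≤s z≤n , s≤s (≤-trans k≤hd (hd-≤ τperm))) ,
    from Avoids312⇔ (◃-avoids312 (IsPermOf.unique τperm) (to Avoids312⇔ av) (s≤s k≤hd)) , refl)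
  (λ {π} πperm (av , hd≡1+k) →
    let ¬occ , hd≤ = stdTail-avoids312 πperm (to Avoids312⇔ av) in
    (from Avoids312⇔ ¬occ , s≤s⁻¹ (subst (_≤ suc (hd (stdTail π))) hd≡1+k hd≤)) , sym hd≡1+k)

count312≥-empty : ∀ {m k} → m < k → count312≥ m k ≡ 0
count312≥-empty {m} {k} m<k = count-none (avoids312-head≥? k)
  (λ τ∈ (_ , k≤hd) → <⇒≱ m<k (≤-trans k≤hd (hd-≤ (∈-perms⁻ {m} τ∈))))

count312≡-zero : ∀ m → count312≡ (suc m) 0 ≡ 0
count312≡-zero m = count-none (avoids312-head≡? 0) head-positive
  where
  head-positive : ∀ {π} → π ∈ perms (suc m) → ¬ (Avoids p312 π × hd π ≡ 0)
  head-positive π∈ _ with ∈-perms⁻ {suc m} π∈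
  head-positive {[]}    _ _          | isPermOf _ () _
  head-positive {_ ∷ _} _ (_ , refl) | isPermOf _ _ ((() , _) ∷ _)

count312≥-diagonal : ∀ m → count312≥ m m ≡ 1
count312≥-diagonal zero    = refl
count312≥-diagonal (suc m) = begin
  count312≥ (suc m) (suc m)                                    ≡⟨ count312≥-split (suc m) (suc m) ⟩
  count312≥ (suc m) (suc (suc m)) + count312≡ (suc m) (suc m)  ≡⟨ cong₂ _+_ (count312≥-empty {suc m} ≤-refl)
                                                                            (count312≡-suc m m) ⟩
  count312≥ m m                                                ≡⟨ count312≥-diagonal m ⟩
  1                                                            ∎
  where open ≡-Reasoning

count312≥-zero : ∀ m → count312≥ (suc m) 0 ≡ count312≥ (suc m) 1
count312≥-zero m = begin
  count312≥ (suc m) 0                        ≡⟨ count312≥-split (suc m) 0 ⟩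
  count312≥ (suc m) 1 + count312≡ (suc m) 0  ≡⟨ cong (_+_ (count312≥ (suc m) 1)) (count312≡-zero m) ⟩
  count312≥ (suc m) 1 + 0                    ≡⟨ +-identityʳ _ ⟩
  count312≥ (suc m) 1                        ∎
  where open ≡-Reasoning

count312≥-suc : ∀ m k → count312≥ (suc m) (suc k) ≡ count312≥ (suc m) (suc (suc k)) + count312≥ m k
count312≥-suc m k = begin
  count312≥ (suc m) (suc k)                                   ≡⟨ count312≥-split (suc m) (suc k) ⟩
  count312≥ (suc m) (suc (suc k)) + count312≡ (suc m) (suc k) ≡⟨ cong (_+_ (count312≥ (suc m) (suc (suc k))))
                                                                        (count312≡-suc m k) ⟩
  count312≥ (suc m) (suc (suc k)) + count312≥ m k             ∎
  where open ≡-Reasoning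

open Ballot count312≥ count312≥-diagonal count312≥-zero count312≥-suc

count-avoids312≡catalan : ∀ n → count (avoids? p312) (perms n) ≡ catalan n
count-avoids312≡catalan n =
  trans (cong length (filter-≐ (avoids? p312) (avoids312-head≥? 0) ((λ av → av , z≤n) , proj₁) (perms n)))
        (g≡catalan n)

Unique-reverse : ∀ {xs : List ℕ} → Unique xs → Unique (reverse xs)
Unique-reverse {xs} = PermutationSetoid.Unique-resp-↭ (setoid ℕ) (↭⇒↭ₛ (↭-sym (↭-reverse xs)))

IsPermOf-reverse : ∀ {n π} → IsPermOf n π → IsPermOf n (reverse π)
IsPermOf-reverse {π = π} (isPermOf u len inRange) =
  isPermOf (Unique-reverse u) (trans (length-reverse π) len) (All-resp-↭ (↭-sym (↭-reverse π)) inRange)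

Occurrence-reverse : ∀ {R R′ : ℕ → ℕ → ℕ → Set} → (∀ {x y z} → R x y z → R′ z y x) →
                     ∀ {π} → Occurrence R π → Occurrence R′ (reverse π)
Occurrence-reverse flip (occurrence x y z s r) = occurrence z y x (Sublist.reverse⁺ s) (flip r)

reverse-avoids : ∀ {R R′ : ℕ → ℕ → ℕ → Set} → (∀ {x y z} → R′ x y z → R z y x) →
                 ∀ {π} → ¬ Occurrence R π → ¬ Occurrence R′ (reverse π)
reverse-avoids {R} flip {π} ¬occ occ =
  ¬occ (subst (Occurrence R) (reverse-involutive π) (Occurrence-reverse flip occ))

count-avoids213≡count-avoids312 : ∀ n → count (avoids? p213) (perms n) ≡ count (avoids? p312) (perms n)
count-avoids213≡count-avoids312 n =
  count-≡ (avoids? p213) (avoids? p312) (Unique-perms n) (Unique-perms n) reverse reverse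
    (λ {π} π∈ av →
      reverse∈perms π∈ , from Avoids312⇔ (reverse-avoids id (to (Avoids213⇔ {π}) av)) , reverse-involutive π)
    (λ {π} π∈ av →
      reverse∈perms π∈ , from Avoids213⇔ (reverse-avoids id (to (Avoids312⇔ {π}) av)) , reverse-involutive π)
  where
  reverse∈perms : ∀ {π} → π ∈ perms n → reverse π ∈ perms n
  reverse∈perms π∈ = ∈-perms⁺ (IsPermOf-reverse (∈-perms⁻ {n} π∈))

count-avoids213≡catalan : ∀ n → count (avoids? p213) (perms n) ≡ catalan n
count-avoids213≡catalan n = trans (count-avoids213≡count-avoids312 n) (count-avoids312≡catalan n)

-- Desarrangements

◃-avoids213 : ∀ {k τ} → All (_< k) τ → ¬ Occurrence R213 τ → ¬ Occurrence R213 (k ◃ τ)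
◃-avoids213 {k} {τ} _ ¬occ (occurrence x y z (_ ∷ʳ s) r) =
  ¬occ (Occurrence213-map⁻ (punchIn-orderEmbedding k) τ (occurrence x y z s r))
◃-avoids213 {k} τ<k _ (occurrence _ _ z (refl ∷ s) (_ , k<z))
  with w , w∈τ , refl ← ∈-map⁻ (punchIn k) (to∈ (Sublist.∷ˡ⁻ s)) =
  <-asym k<z (subst (_< k) (sym (punchIn-< (All.lookup τ<k w∈τ))) (All.lookup τ<k w∈τ))

-- If the first entry k were below n, then k, the smaller entry after it, and n would form a 213.
desarrangement-avoids213⇒hd≡ : ∀ {n π} → IsPermOf n π → Desarrangement π → ¬ Occurrence R213 π → hd π ≡ n
desarrangement-avoids213⇒hd≡ {π = []}    (isPermOf _ refl _) _ _ = refl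
desarrangement-avoids213⇒hd≡ {π = _ ∷ []} _ () _
desarrangement-avoids213⇒hd≡ {n} {k ∷ y ∷ r} πperm d ¬occ with k ≟ n
... | yes k≡n = k≡n
... | no k≢n  = contradiction (occurrence k y n (refl ∷ refl ∷ from∈ n∈r) (y<k , k<n)) ¬occ
  where
  y<k : y < k
  y<k = proj₁ (to (Desarrangement-∷∷ {r = r}) d)
  k<n : k < n
  k<n = ≤∧≢⇒< (proj₂ (All.head (IsPermOf.inRange πperm))) k≢n
  n∈r : n ∈ r
  n∈r with IsPermOf⇒∈ πperm (<-≤-trans (s≤s z≤n) k<n , ≤-refl)
  ... | here n≡k          = contradiction (sym n≡k) k≢n
  ... | there (here n≡y)  = contradiction (<-trans y<k k<n) (<-irrefl (sym n≡y))
  ... | there (there n∈r) = n∈r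

module _ (σ : List ℕ) where

  desarrangementAvoiding? : Decidable (λ π → Desarrangement π × Avoids σ π)
  desarrangementAvoiding? π = desarrangement? π ×-dec avoids? σ π

  nonDesarrangementAvoiding? : Decidable (λ π → ¬ Desarrangement π × Avoids σ π)
  nonDesarrangementAvoiding? π = ¬? (desarrangement? π) ×-dec avoids? σ π

  count-avoids≡d+count-nonDesarrangements :
    ∀ n → count (avoids? σ) (perms n) ≡ d n σ + count nonDesarrangementAvoiding? (perms n)
  count-avoids≡d+count-nonDesarrangements n =
    count-split (avoids? σ) desarrangementAvoiding? nonDesarrangementAvoiding?
      (λ {π} av → case desarrangement? π of λ { (yes d) → inj₁ (d , av) ; (no ¬d) → inj₂ (¬d , av) })
      (λ { (inj₁ (_ , av)) → av ; (inj₂ (_ , av)) → av })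
      (λ (d , _) (¬d , _) → ¬d d)
      (perms n)

d[2+m]-312 : ∀ m → d (suc (suc m)) p312 ≡ count (nonDesarrangementAvoiding? p312) (perms (suc m))
d[2+m]-312 m =
  count-◃ (desarrangementAvoiding? p312) (nonDesarrangementAvoiding? p312) {suc m} (suc ∘ hd)
    (λ {τ} τperm (¬d , av) →
      (s≤s z≤n , s≤s (hd-≤ τperm)) ,
      from (Desarrangement-◃ _ τ) (n<1+n (hd τ) , ¬d) ,
      from Avoids312⇔ (◃-avoids312 (IsPermOf.unique τperm) (to Avoids312⇔ av) ≤-refl))
    (λ {π} πperm (d , av) →
      let hd′<hd , ¬d′ = stdTail-Desarrangement πperm d
          ¬occ′ , hd≤ = stdTail-avoids312 πperm (to Avoids312⇔ av)
      in (¬d′ , from Avoids312⇔ ¬occ′) , ≤-antisym hd′<hd hd≤)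

d[2+m]-213 : ∀ m → d (suc (suc m)) p213 ≡ count (nonDesarrangementAvoiding? p213) (perms (suc m))
d[2+m]-213 m =
  count-◃ (desarrangementAvoiding? p213) (nonDesarrangementAvoiding? p213) {suc m} (λ _ → suc (suc m))
    (λ {τ} τperm (¬d , av) →
      (s≤s z≤n , ≤-refl) ,
      from (Desarrangement-◃ _ τ) (s≤s (hd-≤ τperm) , ¬d) ,
      from Avoids213⇔ (◃-avoids213 (All.map (s≤s ∘ proj₂) (IsPermOf.inRange τperm)) (to Avoids213⇔ av)))
    (λ {π} πperm (d , av) →
      let ¬occ = to Avoids213⇔ av in
      (proj₂ (stdTail-Desarrangement πperm d) ,
       from Avoids213⇔ (¬occ ∘ stdTail-Occurrence (Occurrence213-map⁺ (punchIn-orderEmbedding _)) πperm)) ,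
      sym (desarrangement-avoids213⇒hd≡ πperm d ¬occ))

+[m+n]-+m≡+n : ∀ m n → + (m + n) - + m ≡ + n
+[m+n]-+m≡+n m n = begin
  + (m + n) - + m    ≡⟨ ℤ.m-n≡m⊖n (m + n) m ⟩
  (m + n) ⊖ m        ≡⟨ cong ((m + n) ⊖_) (+-identityʳ m) ⟨
  (m + n) ⊖ (m + 0)  ≡⟨ ℤ.+-cancelˡ-⊖ m n 0 ⟩
  + n                ∎
  where open ≡-Reasoning

module _ (σ : List ℕ) (d₀ : d 0 σ ≡ 1) (d₁ : d 1 σ ≡ 0)
         (d[2+m] : ∀ m → d (suc (suc m)) σ ≡ count (nonDesarrangementAvoiding? σ) (perms (suc m)))
         (count-avoids≡catalan : ∀ n → count (avoids? σ) (perms n) ≡ catalan n) where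

  d+d≡catalan : ∀ n → d n σ + d (suc n) σ ≡ catalan n
  d+d≡catalan zero    = cong₂ _+_ d₀ d₁
  d+d≡catalan (suc m) = begin
    d (suc m) σ + d (suc (suc m)) σ
      ≡⟨ cong (_+_ (d (suc m) σ)) (d[2+m] m) ⟩
    d (suc m) σ + count (nonDesarrangementAvoiding? σ) (perms (suc m))
      ≡⟨ count-avoids≡d+count-nonDesarrangements σ (suc m) ⟨
    count (avoids? σ) (perms (suc m))
      ≡⟨ count-avoids≡catalan (suc m) ⟩
    catalan (suc m)
      ∎
    where open ≡-Reasoning

  d≡a : ∀ n → + d n σ ≡ a n
  d≡a zero    = cong +_ d₀
  d≡a (suc n) = begin
    + d (suc n) σ                       ≡⟨ +[m+n]-+m≡+n (d n σ) (d (suc n) σ) ⟨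
    + (d n σ + d (suc n) σ) - + d n σ   ≡⟨ cong₂ _-_ (cong +_ (d+d≡catalan n)) (d≡a n) ⟩
    + catalan n - a n                   ∎
    where open ≡-Reasoning

theorem3p10 : (n : ℕ) (σ : List ℕ) → (σ ≡ 2 ∷ 1 ∷ 3 ∷ [] ⊎ σ ≡ 3 ∷ 1 ∷ 2 ∷ []) →
    + d n σ ≡ a n
theorem3p10 n σ (inj₁ refl) = d≡a p213 refl refl d[2+m]-213 count-avoids213≡catalan n
theorem3p10 n σ (inj₂ refl) = d≡a p312 refl refl d[2+m]-312 count-avoids312≡catalan n
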